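{- Let $r$ be a positive integer and let $H$ be the graph on the $8r$ vertices $v_{i,j}$ ($1 \le i \le r$, $1 \le j \le 8$) whose edges are: for each $i$, the edges $v_{i,1}v_{i,2}$, $v_{i,1}v_{i,3}$, $v_{i,1}v_{i,4}$, $v_{i,2}v_{i,3}$, $v_{i,3}v_{i,4}$, $v_{i,2}v_{i,5}$, $v_{i,3}v_{i,6}$, $v_{i,4}v_{i,7}$, $v_{i,2}v_{i,7}$, $v_{i,5}v_{i,6}$, $v_{i,6}v_{i,7}$, $v_{i,5}v_{i,8}$, $v_{i,6}v_{i,8}$, $v_{i,7}v_{i,8}$; and, for each $1 \le i \le r-1$, the edge $v_{i,8}v_{i+1,8}$. Then $H$ is $3$-choosable.
   Context: A graph is $k$-choosable if for every assignment of a list of exactly $k$ colours to each vertex there is a proper vertex colouring in which every vertex receives a colour from its own list. -}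

module Defs where

open import Data.Nat using (ℕ; suc)
open import Data.Fin using (Fin; zero; suc; toℕ; #_)
open import Data.Product using (_×_; _,_; Σ-syntax)
open import Data.Sum using (_⊎_)
open import Data.Vec using (Vec; toList)
open import Data.Vec.Membership.Propositional using (_∈_)
open import Data.List.Relation.Unary.Unique.Propositional using (Unique)
open import Relation.Binary.PropositionalEquality using (_≡_; _≢_)

-- A (simple, undirected) graph: a vertex type with an edge relation.
-- Undirectedness is handled by the symmetric closure in `Adj`.
record Graph : Set₁ where
  field
    V    : Set
    Edge : V → V → Set

open Graph public

Adj : (G : Graph) → V G → V G → Set
Adj G u v = Edge G u v ⊎ Edge G v u

ListAssignment : Graph → ℕ → Set
ListAssignment G k = V G → Vec ℕ k

IsExactListAssignment : (G : Graph) (k : ℕ) → ListAssignment G k → Set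
IsExactListAssignment G k L = ∀ v → Unique (toList (L v))

IsProperLColouring : (G : Graph) {k : ℕ} → ListAssignment G k → (V G → ℕ) → Set
IsProperLColouring G L c =
  (∀ v → c v ∈ L v) × (∀ u v → Adj G u v → c u ≢ c v)

Choosable : Graph → ℕ → Set
Choosable G k = (L : ListAssignment G k) → IsExactListAssignment G k L →
  Σ[ c ∈ (V G → ℕ) ] IsProperLColouring G L c

-- The gadget inside each block, vertices v_{i,1..8} encoded as Fin 8
-- with j ↦ j-1 (so v_{i,1} is 0, …, v_{i,8} is 7).
data GadgetEdge : Fin 8 → Fin 8 → Set where
  e12 : GadgetEdge (# 0) (# 1)
  e13 : GadgetEdge (# 0) (# 2)
  e14 : GadgetEdge (# 0) (# 3)
  e23 : GadgetEdge (# 1) (# 2)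
  e34 : GadgetEdge (# 2) (# 3)
  e25 : GadgetEdge (# 1) (# 4)
  e36 : GadgetEdge (# 2) (# 5)
  e47 : GadgetEdge (# 3) (# 6)
  e27 : GadgetEdge (# 1) (# 6)
  e56 : GadgetEdge (# 4) (# 5)
  e67 : GadgetEdge (# 5) (# 6)
  e58 : GadgetEdge (# 4) (# 7)
  e68 : GadgetEdge (# 5) (# 7)
  e78 : GadgetEdge (# 6) (# 7)

-- Edges of H on vertex set Fin r × Fin 8, where (i , j) stands for
-- v_{i+1, j+1}.
data HEdge (r : ℕ) : Fin r × Fin 8 → Fin r × Fin 8 → Set where
  inBlock : ∀ {i a b} → GadgetEdge a b → HEdge r (i , a) (i , b)
  chain   : ∀ {i i'} → suc (toℕ i) ≡ toℕ i' → HEdge r (i , # 7) (i' , # 7)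

H : ℕ → Graph
H r = record { V = Fin r × Fin 8 ; Edge = HEdge r }

-- The blocks of H are joined only through their vertices v_{i,8}, along a path.
-- Colour the blocks in order: when block i is reached, the colour of v_{i-1,8}
-- removes at most one colour from the list of v_{i,8}, so it suffices that the
-- gadget is colourable from lists of size 3 on v_1, …, v_7 and size 2 on v_8.
-- That is a finite case analysis: if L₇ ⊄ L₄, give v₇ a colour outside L₄ and
-- colour greedily; otherwise either v₂ and v₄ can share a colour, which reduces
-- to list-colouring the diamond v₅v₆v₇v₈ (K₄ minus the edge v₅v₇), or L₂ and L₇
-- are disjoint and v₃ can take a colour missing from L₂ or from L₄.
module Submission where

open import Defs
open import Data.Nat using (ℕ; suc; _≤_; _≟_)
open import Data.Nat.Properties using (suc-injective)
open import Data.Fin using (Fin; zero; suc; toℕ; #_)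
open import Data.Product using (Σ-syntax; _×_; _,_; proj₁; proj₂)
open import Data.Sum using (_⊎_; inj₁; inj₂; [_,_])
open import Data.Empty using (⊥; ⊥-elim)
open import Data.Vec using (Vec; []; _∷_; toList)
open import Data.Vec.Relation.Unary.Any using (here; there)
open import Data.Vec.Membership.Propositional using (_∈_)
open import Data.List.Relation.Unary.AllPairs using ([]; _∷_)
open import Data.List.Relation.Unary.All using ([]; _∷_)
open import Data.List.Relation.Unary.Unique.Propositional using (Unique)
open import Function using (_∘_)
open import Relation.Nullary using (¬_; Dec; yes; no)
open import Relation.Nullary.Decidable using (_⊎-dec_; map′)
open import Relation.Binary.PropositionalEquality using (_≡_; _≢_; refl; ≢-sym)

oneOf? : (c u v w : ℕ) → Dec (c ≡ u ⊎ c ≡ v ⊎ c ≡ w)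
oneOf? c u v w = (c ≟ u) ⊎-dec ((c ≟ v) ⊎-dec (c ≟ w))

¬oneOf⇒≢ : {c u v w : ℕ} → ¬ (c ≡ u ⊎ c ≡ v ⊎ c ≡ w) → c ≢ u × c ≢ v × c ≢ w
¬oneOf⇒≢ c∉ = (λ e → c∉ (inj₁ e)) , (λ e → c∉ (inj₂ (inj₁ e))) , (λ e → c∉ (inj₂ (inj₂ e)))

record Triple : Set where
  constructor triple
  field
    x y z : ℕ
    x≢y : x ≢ y
    x≢z : x ≢ z
    y≢z : y ≢ z

open Triple

data _∈₃_ (c : ℕ) (t : Triple) : Set where
  is-x : c ≡ x t → c ∈₃ t
  is-y : c ≡ y t → c ∈₃ t
  is-z : c ≡ z t → c ∈₃ t

oneOf⇒∈₃ : ∀ {c t} → c ≡ x t ⊎ c ≡ y t ⊎ c ≡ z t → c ∈₃ t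
oneOf⇒∈₃ = [ is-x , [ is-y , is-z ] ]

∈₃⇒oneOf : ∀ {c t} → c ∈₃ t → c ≡ x t ⊎ c ≡ y t ⊎ c ≡ z t
∈₃⇒oneOf (is-x e) = inj₁ e
∈₃⇒oneOf (is-y e) = inj₂ (inj₁ e)
∈₃⇒oneOf (is-z e) = inj₂ (inj₂ e)

_∈₃?_ : (c : ℕ) (t : Triple) → Dec (c ∈₃ t)
c ∈₃? t = map′ oneOf⇒∈₃ ∈₃⇒oneOf (oneOf? c (x t) (y t) (z t))

∈₃-elim : (P : ℕ → Set) (t : Triple) → P (x t) → P (y t) → P (z t) → ∀ {c} → c ∈₃ t → P c
∈₃-elim P t px py pz (is-x refl) = px
∈₃-elim P t px py pz (is-y refl) = py
∈₃-elim P t px py pz (is-z refl) = pz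

∈₃-∉₃⇒≢ : ∀ {c d t} → c ∈₃ t → ¬ d ∈₃ t → c ≢ d
∈₃-∉₃⇒≢ c∈t d∉t refl = d∉t c∈t

Disjoint₃ : Triple → Triple → Set
Disjoint₃ s t = ∀ {c} → c ∈₃ s → ¬ c ∈₃ t

disjoint⇒≢ : ∀ {s t c d} → Disjoint₃ s t → c ∈₃ s → d ∈₃ t → c ≢ d
disjoint⇒≢ s∩t≡∅ c∈s d∈t refl = s∩t≡∅ c∈s d∈t

meet⊎disjoint : (s t : Triple) → (Σ[ c ∈ ℕ ] c ∈₃ s × c ∈₃ t) ⊎ Disjoint₃ s t
meet⊎disjoint s t with x t ∈₃? s | y t ∈₃? s | z t ∈₃? s
... | yes x∈s | _       | _       = inj₁ (x t , x∈s , is-x refl)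
... | no _    | yes y∈s | _       = inj₁ (y t , y∈s , is-y refl)
... | no _    | no _    | yes z∈s = inj₁ (z t , z∈s , is-z refl)
... | no x∉s  | no y∉s  | no z∉s  = inj₂ λ c∈s c∈t → ∈₃-elim (λ c → ¬ c ∈₃ s) t x∉s y∉s z∉s c∈t c∈s

Avoids : Triple → ℕ → ℕ → ℕ → Set
Avoids t u v w = Σ[ c ∈ ℕ ] c ∈₃ t × c ≢ u × c ≢ v × c ≢ w

Covered : Triple → ℕ → ℕ → ℕ → Set
Covered t u v w = ∀ {c} → c ∈₃ t → c ≡ u ⊎ c ≡ v ⊎ c ≡ w

avoids-swap : ∀ {t u v w} → Avoids t u v w → Avoids t u w v
avoids-swap (c , c∈t , c≢u , c≢v , c≢w) = c , c∈t , c≢u , c≢w , c≢v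

covered-swap : ∀ {t u v w} → Covered t u v w → Covered t u w v
covered-swap cov c∈t = [ inj₁ , [ inj₂ ∘ inj₂ , inj₂ ∘ inj₁ ] ] (cov c∈t)

avoids⊎covered : (t : Triple) (u v w : ℕ) → Avoids t u v w ⊎ Covered t u v w
avoids⊎covered t u v w with oneOf? (x t) u v w | oneOf? (y t) u v w | oneOf? (z t) u v w
... | no x∉  | _      | _      = inj₁ (x t , is-x refl , ¬oneOf⇒≢ x∉)
... | yes _  | no y∉  | _      = inj₁ (y t , is-y refl , ¬oneOf⇒≢ y∉)
... | yes _  | yes _  | no z∉  = inj₁ (z t , is-z refl , ¬oneOf⇒≢ z∉)
... | yes x∈ | yes y∈ | yes z∈ = inj₂ (∈₃-elim (λ c → c ≡ u ⊎ c ≡ v ⊎ c ≡ w) t x∈ y∈ z∈)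

¬covered-by-two : (t : Triple) (u v : ℕ) → ¬ (∀ {c} → c ∈₃ t → c ≡ u ⊎ c ≡ v)
¬covered-by-two t u v cov with cov (is-x refl) | cov (is-y refl) | cov (is-z refl)
... | inj₁ refl | inj₁ refl | _         = x≢y t refl
... | inj₂ refl | inj₂ refl | _         = x≢y t refl
... | inj₁ refl | _         | inj₁ refl = x≢z t refl
... | inj₂ refl | _         | inj₂ refl = x≢z t refl
... | _         | inj₁ refl | inj₁ refl = y≢z t refl
... | _         | inj₂ refl | inj₂ refl = y≢z t refl

avoid₂ : (t : Triple) (u v : ℕ) → Σ[ c ∈ ℕ ] c ∈₃ t × c ≢ u × c ≢ v
avoid₂ t u v with avoids⊎covered t u v v
... | inj₁ (c , c∈t , c≢u , c≢v , _) = c , c∈t , c≢u , c≢v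
... | inj₂ cov = ⊥-elim (¬covered-by-two t u v ([ inj₁ , [ inj₂ , inj₂ ] ] ∘ cov))

covered-twice : ∀ {t u v w w′} → w ≢ w′ → Covered t u v w → Covered t u v w′ → ⊥
covered-twice {t} {u} {v} {w} {w′} w≢w′ cov cov′ = ¬covered-by-two t u v (λ c∈t → merge (cov c∈t) (cov′ c∈t))
  where
  merge : ∀ {c} → c ≡ u ⊎ c ≡ v ⊎ c ≡ w → c ≡ u ⊎ c ≡ v ⊎ c ≡ w′ → c ≡ u ⊎ c ≡ v
  merge (inj₁ c≡u)         _                  = inj₁ c≡u
  merge (inj₂ (inj₁ c≡v))  _                  = inj₂ c≡v
  merge (inj₂ (inj₂ _))    (inj₁ c≡u)         = inj₁ c≡u
  merge (inj₂ (inj₂ _))    (inj₂ (inj₁ c≡v))  = inj₂ c≡v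
  merge (inj₂ (inj₂ refl)) (inj₂ (inj₂ refl)) = ⊥-elim (w≢w′ refl)

covered⇒avoids : ∀ {t u v w w′} → w ≢ w′ → Covered t u w v → Avoids t u v w′
covered⇒avoids {t} {u} {v} {w} {w′} w≢w′ cov with avoids⊎covered t u v w′
... | inj₁ avoids = avoids
... | inj₂ cov′   = ⊥-elim (covered-twice w≢w′ (covered-swap cov) cov′)

_⊆₃_ : Triple → Triple → Set
s ⊆₃ t = ∀ {c} → c ∈₃ s → c ∈₃ t

⊈₃⊎⊆₃ : (s t : Triple) → (Σ[ c ∈ ℕ ] c ∈₃ s × ¬ c ∈₃ t) ⊎ s ⊆₃ t
⊈₃⊎⊆₃ s t with avoids⊎covered s (x t) (y t) (z t)
... | inj₁ (c , c∈s , c≢x , c≢y , c≢z) = inj₁ (c , c∈s , [ c≢x , [ c≢y , c≢z ] ] ∘ ∈₃⇒oneOf)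
... | inj₂ cov = inj₂ (oneOf⇒∈₃ ∘ cov)

record Pair : Set where
  constructor pair
  field
    a b : ℕ
    a≢b : a ≢ b

data _∈₂_ (c : ℕ) (p : Pair) : Set where
  is-a : c ≡ Pair.a p → c ∈₂ p
  is-b : c ≡ Pair.b p → c ∈₂ p

avoid₁ : (p : Pair) (u : ℕ) → Σ[ c ∈ ℕ ] c ∈₂ p × c ≢ u
avoid₁ (pair a b a≢b) u with a ≟ u
... | yes refl = b , is-b refl , ≢-sym a≢b
... | no a≢u   = a , is-a refl , a≢u

dropColour : (t : Triple) (f : ℕ) → Σ[ p ∈ Pair ] (∀ {c} → c ∈₂ p → c ∈₃ t × c ≢ f)
dropColour t f with avoid₂ t f f
... | a , a∈t , a≢f , _ with avoid₂ t f a
...   | b , b∈t , b≢f , b≢a = pair a b (≢-sym b≢a) , λ { (is-a refl) → a∈t , a≢f ; (is-b refl) → b∈t , b≢f }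

-- K₄ minus the edge pq, with p and q forbidden one colour each.
module Diamond (P Q S : Triple) (T : Pair) (xp xq : ℕ) where

  record DiamondColouring : Set where
    constructor diamond
    field
      cp cq cs ct : ℕ
      cp∈P : cp ∈₃ P
      cq∈Q : cq ∈₃ Q
      cs∈S : cs ∈₃ S
      ct∈T : ct ∈₂ T
      cp≢xp : cp ≢ xp
      cq≢xq : cq ≢ xq
      cp≢cs : cp ≢ cs
      cp≢ct : cp ≢ ct
      cq≢cs : cq ≢ cs
      cq≢ct : cq ≢ ct
      cs≢ct : cs ≢ ct

  open Pair T

  diamond-via : ∀ {cs ct} → cs ∈₃ S → ct ∈₂ T → cs ≢ ct →
                Avoids P xp cs ct → Avoids Q xq cs ct → DiamondColouring
  diamond-via {cs} {ct} cs∈S ct∈T cs≢ct (cp , cp∈P , cp≢xp , cp≢cs , cp≢ct) (cq , cq∈Q , cq≢xq , cq≢cs , cq≢ct) =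
    diamond cp cq cs ct cp∈P cq∈Q cs∈S ct∈T cp≢xp cq≢xq cp≢cs cp≢ct cq≢cs cq≢ct cs≢ct

  diamond-outside : ∀ {ct} → ct ∈₂ T → ¬ ct ∈₃ S → DiamondColouring
  diamond-outside {ct} ct∈T ct∉S =
    let (cp , cp∈P , cp≢xp , cp≢ct) = avoid₂ P xp ct
        (cq , cq∈Q , cq≢xq , cq≢ct) = avoid₂ Q xq ct
        (cs , cs∈S , cs≢cp , cs≢cq) = avoid₂ S cp cq
    in diamond cp cq cs ct cp∈P cq∈Q cs∈S ct∈T cp≢xp cq≢xq (≢-sym cs≢cp) cp≢ct (≢-sym cs≢cq) cq≢ct
         (∈₃-∉₃⇒≢ cs∈S ct∉S)

  -- With S = {a, b, d}, each of P and Q is covered by {x, s, t} (x = xp, xq) for at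
  -- most one of the pairs {s, t} = {d, a}, {d, b}, {a, b}, so some pair is free for both.
  diamond-inside : a ∈₃ S → b ∈₃ S → DiamondColouring
  diamond-inside a∈S b∈S with avoid₂ S a b
  ... | d , d∈S , d≢a , d≢b
    with avoids⊎covered P xp d a | avoids⊎covered Q xq d a | avoids⊎covered P xp d b | avoids⊎covered Q xq d b
  ... | inj₁ avP | inj₁ avQ | _        | _        = diamond-via d∈S (is-a refl) d≢a avP avQ
  ... | _        | _        | inj₁ avP | inj₁ avQ = diamond-via d∈S (is-b refl) d≢b avP avQ
  ... | inj₂ covP | _       | inj₂ covP′ | _      = ⊥-elim (covered-twice a≢b covP covP′)
  ... | _        | inj₂ covQ | _       | inj₂ covQ′ = ⊥-elim (covered-twice a≢b covQ covQ′)
  ... | inj₂ covP | inj₁ _  | inj₁ _   | inj₂ covQ =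
    diamond-via a∈S (is-b refl) a≢b (covered⇒avoids d≢b covP) (avoids-swap (covered⇒avoids d≢a covQ))
  ... | inj₁ _   | inj₂ covQ | inj₂ covP | inj₁ _ =
    diamond-via b∈S (is-a refl) (≢-sym a≢b) (covered⇒avoids d≢a covP) (avoids-swap (covered⇒avoids d≢b covQ))

  diamondColouring : DiamondColouring
  diamondColouring with a ∈₃? S | b ∈₃? S
  ... | no a∉S  | _       = diamond-outside (is-a refl) a∉S
  ... | yes _   | no b∉S  = diamond-outside (is-b refl) b∉S
  ... | yes a∈S | yes b∈S = diamond-inside a∈S b∈S

module Gadget (L₁ L₂ L₃ L₄ L₅ L₆ L₇ : Triple) (L₈ : Pair) where

  record GadgetColouring : Set where
    constructor gadget
    field
      c₁ c₂ c₃ c₄ c₅ c₆ c₇ c₈ : ℕ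
      c₁∈ : c₁ ∈₃ L₁
      c₂∈ : c₂ ∈₃ L₂
      c₃∈ : c₃ ∈₃ L₃
      c₄∈ : c₄ ∈₃ L₄
      c₅∈ : c₅ ∈₃ L₅
      c₆∈ : c₆ ∈₃ L₆
      c₇∈ : c₇ ∈₃ L₇
      c₈∈ : c₈ ∈₂ L₈
      c₁≢c₂ : c₁ ≢ c₂
      c₁≢c₃ : c₁ ≢ c₃
      c₁≢c₄ : c₁ ≢ c₄
      c₂≢c₃ : c₂ ≢ c₃
      c₃≢c₄ : c₃ ≢ c₄
      c₂≢c₅ : c₂ ≢ c₅
      c₃≢c₆ : c₃ ≢ c₆
      c₄≢c₇ : c₄ ≢ c₇
      c₂≢c₇ : c₂ ≢ c₇
      c₅≢c₆ : c₅ ≢ c₆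
      c₆≢c₇ : c₆ ≢ c₇
      c₅≢c₈ : c₅ ≢ c₈
      c₆≢c₈ : c₆ ≢ c₈
      c₇≢c₈ : c₇ ≢ c₈

  colouring-c₇∉L₄ : ∀ {c₇} → c₇ ∈₃ L₇ → ¬ c₇ ∈₃ L₄ → GadgetColouring
  colouring-c₇∉L₄ {c₇} c₇∈ c₇∉L₄ =
    let (c₈ , c₈∈ , c₈≢c₇) = avoid₁ L₈ c₇
        (c₆ , c₆∈ , c₆≢c₇ , c₆≢c₈) = avoid₂ L₆ c₇ c₈
        (c₅ , c₅∈ , c₅≢c₆ , c₅≢c₈) = avoid₂ L₅ c₆ c₈
        (c₂ , c₂∈ , c₂≢c₅ , c₂≢c₇) = avoid₂ L₂ c₅ c₇
        (c₃ , c₃∈ , c₃≢c₂ , c₃≢c₆) = avoid₂ L₃ c₂ c₆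
        (c₁ , c₁∈ , c₁≢c₂ , c₁≢c₃) = avoid₂ L₁ c₂ c₃
        (c₄ , c₄∈ , c₄≢c₁ , c₄≢c₃) = avoid₂ L₄ c₁ c₃
    in gadget c₁ c₂ c₃ c₄ c₅ c₆ c₇ c₈ c₁∈ c₂∈ c₃∈ c₄∈ c₅∈ c₆∈ c₇∈ c₈∈
         c₁≢c₂ c₁≢c₃ (≢-sym c₄≢c₁) (≢-sym c₃≢c₂) (≢-sym c₄≢c₃) c₂≢c₅ c₃≢c₆ (∈₃-∉₃⇒≢ c₄∈ c₇∉L₄)
         c₂≢c₇ c₅≢c₆ c₆≢c₇ c₅≢c₈ c₆≢c₈ (≢-sym c₈≢c₇)

  colouring-c₂≡c₄ : ∀ {c} → c ∈₃ L₂ → c ∈₃ L₄ → GadgetColouring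
  colouring-c₂≡c₄ {c} c∈L₂ c∈L₄ with Diamond.diamondColouring L₅ L₇ L₆ L₈ c c
  ... | Diamond.diamond c₅ c₇ c₆ c₈ c₅∈ c₇∈ c₆∈ c₈∈ c₅≢c c₇≢c c₅≢c₆ c₅≢c₈ c₇≢c₆ c₇≢c₈ c₆≢c₈ =
    let (c₃ , c₃∈ , c₃≢c , c₃≢c₆) = avoid₂ L₃ c c₆
        (c₁ , c₁∈ , c₁≢c , c₁≢c₃) = avoid₂ L₁ c c₃
    in gadget c₁ c c₃ c c₅ c₆ c₇ c₈ c₁∈ c∈L₂ c₃∈ c∈L₄ c₅∈ c₆∈ c₇∈ c₈∈
         c₁≢c c₁≢c₃ c₁≢c (≢-sym c₃≢c) c₃≢c (≢-sym c₅≢c) c₃≢c₆ (≢-sym c₇≢c) (≢-sym c₇≢c)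
         c₅≢c₆ (≢-sym c₇≢c₆) c₅≢c₈ c₆≢c₈ c₇≢c₈

  colouring-c₃∉L₂ : ∀ {c₃} → c₃ ∈₃ L₃ → ¬ c₃ ∈₃ L₂ → Disjoint₃ L₂ L₇ → GadgetColouring
  colouring-c₃∉L₂ {c₃} c₃∈ c₃∉L₂ L₂∩L₇≡∅ =
    let (c₆ , c₆∈ , c₆≢c₃ , _) = avoid₂ L₆ c₃ c₃
        (c₈ , c₈∈ , c₈≢c₆) = avoid₁ L₈ c₆
        (c₅ , c₅∈ , c₅≢c₆ , c₅≢c₈) = avoid₂ L₅ c₆ c₈
        (c₇ , c₇∈ , c₇≢c₆ , c₇≢c₈) = avoid₂ L₇ c₆ c₈
        (c₄ , c₄∈ , c₄≢c₃ , c₄≢c₇) = avoid₂ L₄ c₃ c₇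
        (c₁ , c₁∈ , c₁≢c₃ , c₁≢c₄) = avoid₂ L₁ c₃ c₄
        (c₂ , c₂∈ , c₂≢c₁ , c₂≢c₅) = avoid₂ L₂ c₁ c₅
    in gadget c₁ c₂ c₃ c₄ c₅ c₆ c₇ c₈ c₁∈ c₂∈ c₃∈ c₄∈ c₅∈ c₆∈ c₇∈ c₈∈
         (≢-sym c₂≢c₁) c₁≢c₃ c₁≢c₄ (∈₃-∉₃⇒≢ c₂∈ c₃∉L₂) (≢-sym c₄≢c₃) c₂≢c₅ (≢-sym c₆≢c₃) c₄≢c₇
         (disjoint⇒≢ L₂∩L₇≡∅ c₂∈ c₇∈) c₅≢c₆ (≢-sym c₇≢c₆) c₅≢c₈ (≢-sym c₈≢c₆) c₇≢c₈

  colouring-c₃∉L₄ : ∀ {c₃} → c₃ ∈₃ L₃ → ¬ c₃ ∈₃ L₄ → Disjoint₃ L₂ L₇ → GadgetColouring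
  colouring-c₃∉L₄ {c₃} c₃∈ c₃∉L₄ L₂∩L₇≡∅ =
    let (c₆ , c₆∈ , c₆≢c₃ , _) = avoid₂ L₆ c₃ c₃
        (c₈ , c₈∈ , c₈≢c₆) = avoid₁ L₈ c₆
        (c₅ , c₅∈ , c₅≢c₆ , c₅≢c₈) = avoid₂ L₅ c₆ c₈
        (c₂ , c₂∈ , c₂≢c₃ , c₂≢c₅) = avoid₂ L₂ c₃ c₅
        (c₁ , c₁∈ , c₁≢c₂ , c₁≢c₃) = avoid₂ L₁ c₂ c₃
        (c₇ , c₇∈ , c₇≢c₆ , c₇≢c₈) = avoid₂ L₇ c₆ c₈
        (c₄ , c₄∈ , c₄≢c₁ , c₄≢c₇) = avoid₂ L₄ c₁ c₇
    in gadget c₁ c₂ c₃ c₄ c₅ c₆ c₇ c₈ c₁∈ c₂∈ c₃∈ c₄∈ c₅∈ c₆∈ c₇∈ c₈∈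
         c₁≢c₂ c₁≢c₃ (≢-sym c₄≢c₁) c₂≢c₃ (≢-sym (∈₃-∉₃⇒≢ c₄∈ c₃∉L₄)) c₂≢c₅ (≢-sym c₆≢c₃) c₄≢c₇
         (disjoint⇒≢ L₂∩L₇≡∅ c₂∈ c₇∈) c₅≢c₆ (≢-sym c₇≢c₆) c₅≢c₈ (≢-sym c₈≢c₆) c₇≢c₈

  gadgetColouring : GadgetColouring
  gadgetColouring with ⊈₃⊎⊆₃ L₇ L₄
  ... | inj₁ (c₇ , c₇∈ , c₇∉L₄) = colouring-c₇∉L₄ c₇∈ c₇∉L₄
  ... | inj₂ L₇⊆L₄ with meet⊎disjoint L₂ L₇
  ...   | inj₁ (c , c∈L₂ , c∈L₇) = colouring-c₂≡c₄ c∈L₂ (L₇⊆L₄ c∈L₇)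
  ...   | inj₂ L₂∩L₇≡∅ with x L₃ ∈₃? L₂ | x L₃ ∈₃? L₄
  ...     | no ∉L₂  | _       = colouring-c₃∉L₂ (is-x refl) ∉L₂ L₂∩L₇≡∅
  ...     | yes ∈L₂ | yes ∈L₄ = colouring-c₂≡c₄ ∈L₂ ∈L₄
  ...     | yes _   | no ∉L₄  = colouring-c₃∉L₄ (is-x refl) ∉L₄ L₂∩L₇≡∅

record BlockColouring (B : Fin 8 → Triple) (f : ℕ) : Set where
  field
    colour    : Fin 8 → ℕ
    colour-∈  : ∀ j → colour j ∈₃ B j
    colour₈≢f : colour (# 7) ≢ f
    proper    : ∀ {j k} → GadgetEdge j k → colour j ≢ colour k

open BlockColouring

blockColouring : (B : Fin 8 → Triple) (f : ℕ) → BlockColouring B f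
blockColouring B f with dropColour (B (# 7)) f
... | L₈ , L₈⊆B₇-f = record
  { colour    = colours
  ; colour-∈  = colours-∈
  ; colour₈≢f = proj₂ (L₈⊆B₇-f c₈∈)
  ; proper    = colours-proper
  }
  where
  open Gadget (B (# 0)) (B (# 1)) (B (# 2)) (B (# 3)) (B (# 4)) (B (# 5)) (B (# 6)) L₈
  open GadgetColouring gadgetColouring

  colours : Fin 8 → ℕ
  colours zero                                      = c₁
  colours (suc zero)                                = c₂
  colours (suc (suc zero))                          = c₃
  colours (suc (suc (suc zero)))                    = c₄
  colours (suc (suc (suc (suc zero))))              = c₅
  colours (suc (suc (suc (suc (suc zero)))))        = c₆
  colours (suc (suc (suc (suc (suc (suc zero))))))  = c₇
  colours (suc (suc (suc (suc (suc (suc (suc zero))))))) = c₈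

  colours-∈ : ∀ j → colours j ∈₃ B j
  colours-∈ zero                                      = c₁∈
  colours-∈ (suc zero)                                = c₂∈
  colours-∈ (suc (suc zero))                          = c₃∈
  colours-∈ (suc (suc (suc zero)))                    = c₄∈
  colours-∈ (suc (suc (suc (suc zero))))              = c₅∈
  colours-∈ (suc (suc (suc (suc (suc zero)))))        = c₆∈
  colours-∈ (suc (suc (suc (suc (suc (suc zero))))))  = c₇∈
  colours-∈ (suc (suc (suc (suc (suc (suc (suc zero))))))) = proj₁ (L₈⊆B₇-f c₈∈)

  colours-proper : ∀ {j k} → GadgetEdge j k → colours j ≢ colours k
  colours-proper e12 = c₁≢c₂
  colours-proper e13 = c₁≢c₃
  colours-proper e14 = c₁≢c₄
  colours-proper e23 = c₂≢c₃
  colours-proper e34 = c₃≢c₄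
  colours-proper e25 = c₂≢c₅
  colours-proper e36 = c₃≢c₆
  colours-proper e47 = c₄≢c₇
  colours-proper e27 = c₂≢c₇
  colours-proper e56 = c₅≢c₆
  colours-proper e67 = c₆≢c₇
  colours-proper e58 = c₅≢c₈
  colours-proper e68 = c₆≢c₈
  colours-proper e78 = c₇≢c₈

exitColour : ∀ {r} → (Fin (suc r) → Fin 8 → Triple) → ℕ → ℕ
exitColour blocks f = colour (blockColouring (blocks zero) f) (# 7)

colourBlocks : ∀ {r} → (Fin r → Fin 8 → Triple) → ℕ → Fin r → Fin 8 → ℕ
colourBlocks blocks f zero    = colour (blockColouring (blocks zero) f)
colourBlocks blocks f (suc i) = colourBlocks (blocks ∘ suc) (exitColour blocks f) i

colourBlocks-∈ : ∀ {r} (blocks : Fin r → Fin 8 → Triple) f i j → colourBlocks blocks f i j ∈₃ blocks i j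
colourBlocks-∈ blocks f zero    j = colour-∈ (blockColouring (blocks zero) f) j
colourBlocks-∈ blocks f (suc i) j = colourBlocks-∈ (blocks ∘ suc) (exitColour blocks f) i j

colourBlocks-inBlock : ∀ {r} (blocks : Fin r → Fin 8 → Triple) f i {j k} → GadgetEdge j k →
                       colourBlocks blocks f i j ≢ colourBlocks blocks f i k
colourBlocks-inBlock blocks f zero    e = proper (blockColouring (blocks zero) f) e
colourBlocks-inBlock blocks f (suc i) e = colourBlocks-inBlock (blocks ∘ suc) (exitColour blocks f) i e

colourBlocks-chain : ∀ {r} (blocks : Fin r → Fin 8 → Triple) f (i i′ : Fin r) → suc (toℕ i) ≡ toℕ i′ →
                     colourBlocks blocks f i (# 7) ≢ colourBlocks blocks f i′ (# 7)
colourBlocks-chain blocks f zero    zero          ()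
colourBlocks-chain blocks f zero    (suc zero)    refl =
  ≢-sym (colour₈≢f (blockColouring (blocks (suc zero)) (exitColour blocks f)))
colourBlocks-chain blocks f zero    (suc (suc _)) ()
colourBlocks-chain blocks f (suc i) zero          ()
colourBlocks-chain blocks f (suc i) (suc i′)      eq   =
  colourBlocks-chain (blocks ∘ suc) (exitColour blocks f) i i′ (suc-injective eq)

toTriple : (v : Vec ℕ 3) → Unique (toList v) → Triple
toTriple (x ∷ y ∷ z ∷ []) ((x≢y ∷ x≢z ∷ []) ∷ (y≢z ∷ []) ∷ [] ∷ []) = triple x y z x≢y x≢z y≢z

∈₃-toTriple⇒∈ : ∀ {c} (v : Vec ℕ 3) (distinct : Unique (toList v)) → c ∈₃ toTriple v distinct → c ∈ v
∈₃-toTriple⇒∈ (_ ∷ _ ∷ _ ∷ []) ((_ ∷ _ ∷ []) ∷ (_ ∷ []) ∷ [] ∷ []) (is-x c≡x) = here c≡x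
∈₃-toTriple⇒∈ (_ ∷ _ ∷ _ ∷ []) ((_ ∷ _ ∷ []) ∷ (_ ∷ []) ∷ [] ∷ []) (is-y c≡y) = there (here c≡y)
∈₃-toTriple⇒∈ (_ ∷ _ ∷ _ ∷ []) ((_ ∷ _ ∷ []) ∷ (_ ∷ []) ∷ [] ∷ []) (is-z c≡z) = there (there (here c≡z))

mainTheorem11 : (r : ℕ) → 1 ≤ r → Choosable (H r) 3
mainTheorem11 r _ L distinct = colouring , colouring-∈ , colouring-proper
  where
  blocks : Fin r → Fin 8 → Triple
  blocks i j = toTriple (L (i , j)) (distinct (i , j))

  colouring : Fin r × Fin 8 → ℕ
  colouring (i , j) = colourBlocks blocks 0 i j

  colouring-∈ : ∀ v → colouring v ∈ L v
  colouring-∈ (i , j) = ∈₃-toTriple⇒∈ (L (i , j)) (distinct (i , j)) (colourBlocks-∈ blocks 0 i j)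

  edge-proper : ∀ {u v} → HEdge r u v → colouring u ≢ colouring v
  edge-proper {i , _} (inBlock e)       = colourBlocks-inBlock blocks 0 i e
  edge-proper {i , _} {i′ , _} (chain e) = colourBlocks-chain blocks 0 i i′ e

  colouring-proper : ∀ u v → Adj (H r) u v → colouring u ≢ colouring v
  colouring-proper u v (inj₁ e) = edge-proper e
  colouring-proper u v (inj₂ e) = ≢-sym (edge-proper e)
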